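{- Let $G$ be a connected graph with no subgraph isomorphic to $Y$, and let $P=v_0v_1\dots v_\ell$ be a longest path in $G$ with $\ell\ge5$. For $0\le i\le\ell$ let $L_i=N_G(v_i)\setminus V(P)$. If $i,j,k$ are distinct, then $L_i\cap L_j\cap L_k=\emptyset$.
   Context: All graphs are finite and simple. $Y$ is the 7-vertex tree obtained from $K_{1,3}$ by subdividing each edge exactly once. -}

module Defs where

open import Level using (0ℓ)
open import Data.Nat using (ℕ; suc; _≤_)
open import Data.Fin using (Fin; zero; suc; inject₁)
open import Data.Product using (Σ; ∃; _×_; _,_)
open import Data.Empty using (⊥)
open import Relation.Nullary using (¬_)
open import Relation.Binary.PropositionalEquality using (_≡_)
open import Function.Definitions using (Injective)

record Graph (n : ℕ) : Set₁ where
  field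
    Adj     : Fin n → Fin n → Set
    sym     : ∀ {u v} → Adj u v → Adj v u
    irrefl  : ∀ {u} → ¬ Adj u u
open Graph public

data Walk {n : ℕ} (G : Graph n) : Fin n → Fin n → Set where
  here : ∀ {u} → Walk G u u
  step : ∀ {u w v} → Adj G u w → Walk G w v → Walk G u v

Connected : ∀ {n} → Graph n → Set
Connected G = ∀ u v → Walk G u v

record Path {n : ℕ} (G : Graph n) (ℓ : ℕ) : Set where
  field
    vtx   : Fin (suc ℓ) → Fin n
    inj   : Injective _≡_ _≡_ vtx
    adj   : ∀ (i : Fin ℓ) → Adj G (vtx (inject₁ i)) (vtx (suc i))
open Path public

Longest : ∀ {n ℓ} {G : Graph n} → Path G ℓ → Set
Longest {n} {ℓ} {G} _ = ∀ m → Path G m → m ≤ ℓ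

-- The tree Y: K_{1,3} with each edge subdivided once.
-- Vertex 0 is the centre, 1,2,3 its neighbours, 4,5,6 the leaves
-- (4 ~ 1, 5 ~ 2, 6 ~ 3).
data YEdge : Fin 7 → Fin 7 → Set where
  e01 : YEdge zero (suc zero)
  e02 : YEdge zero (suc (suc zero))
  e03 : YEdge zero (suc (suc (suc zero)))
  e14 : YEdge (suc zero) (suc (suc (suc (suc zero))))
  e25 : YEdge (suc (suc zero)) (suc (suc (suc (suc (suc zero)))))
  e36 : YEdge (suc (suc (suc zero))) (suc (suc (suc (suc (suc (suc zero))))))

HasYSubgraph : ∀ {n} → Graph n → Set
HasYSubgraph {n} G =
  Σ (Fin 7 → Fin n) λ f → Injective _≡_ _≡_ f × (∀ a b → YEdge a b → Adj G (f a) (f b))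

OnPath : ∀ {n ℓ} {G : Graph n} → Path G ℓ → Fin n → Set
OnPath P x = ∃ λ i → vtx P i ≡ x

L : ∀ {n ℓ} {G : Graph n} → Path G ℓ → Fin (suc ℓ) → Fin n → Set
L {G = G} P i x = Adj G (vtx P i) x × ¬ OnPath P x

-- If a vertex x off a longest path P has three neighbours v_a, v_b, v_c on P
-- (a < b < c), then either x can be spliced into P (a = 0, c = ℓ or c = b + 1),
-- contradicting maximality, or x together with v_{a-1} v_a, v_b v_{b+1} and
-- v_c v_{c+1} forms a copy of Y.
module Submission where

open import Defs hiding (sym)
open import Level using (Level)
open import Data.Nat using (ℕ; suc; _≤_; z≤n; s≤s; s≤s⁻¹)
import Data.Nat.Properties as ℕ
open import Data.Fin using (Fin; zero; suc; inject₁; fromℕ; _<_; #_)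
import Data.Fin as Fin
open import Data.Fin.Properties
  using (_≟_; <-cmp; <-trans; <-irrefl; ≤-refl; ≤∧≢⇒<; ≤fromℕ; ≤̄⇒inject₁<; inject₁-injective;
         toℕ-inject₁; fromℕ≢inject₁; punchIn-punchOut; punchOut-injective)
open import Data.Fin.Relation.Unary.Top using (view; ‵fromℕ; ‵inject₁)
open import Data.Vec.Functional using (Vector; tail; insertAt)
open import Data.Vec.Functional.Properties using (insertAt-lookup; insertAt-punchIn)
open import Data.Product using (_×_; _,_)
open import Data.Empty using (⊥)
open import Relation.Nullary using (¬_; yes; no; contradiction)
open import Relation.Binary.Core using (Rel)
open import Relation.Binary.Definitions using (Transitive; Irreflexive; tri<; tri≈; tri>)
open import Relation.Binary.PropositionalEquality
  using (_≡_; _≢_; refl; sym; trans; cong; subst; module ≡-Reasoning)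
open import Function.Definitions using (Injective)

private
  variable
    a r : Level
    A : Set a
    m : ℕ

Linked : Rel A r → Vector A (suc m) → Set r
Linked R xs = ∀ i → R (xs (inject₁ i)) (xs (suc i))

module _ {R : Rel A r} where

  linked-tail : {xs : Vector A (suc (suc m))} → Linked R xs → Linked R (tail xs)
  linked-tail linked i = linked (suc i)

  linked⇒related : Transitive R → {xs : Vector A (suc m)} → Linked R xs →
                   ∀ {i j} → i < j → R (xs i) (xs j)
  linked⇒related _ linked {zero} {suc zero} _ = linked zero
  linked⇒related R-trans {xs} linked {zero} {suc (suc j)} _ =
    R-trans (linked zero)
            (linked⇒related R-trans {tail xs} (linked-tail {xs = xs} linked) {zero} {suc j} (s≤s z≤n))
  linked⇒related {m = suc _} R-trans {xs} linked {suc i} {suc j} i<j =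
    linked⇒related R-trans {tail xs} (linked-tail {xs = xs} linked) (s≤s⁻¹ i<j)

  linked⇒injective : Transitive R → Irreflexive _≡_ R → {xs : Vector A (suc m)} →
                     Linked R xs → Injective _≡_ _≡_ xs
  linked⇒injective R-trans R-irrefl {xs} linked {i} {j} xsi≡xsj with <-cmp i j
  ... | tri< i<j _ _ = contradiction (linked⇒related R-trans {xs} linked i<j) (R-irrefl xsi≡xsj)
  ... | tri≈ _ i≡j _ = i≡j
  ... | tri> _ _ j<i = contradiction (linked⇒related R-trans {xs} linked j<i) (R-irrefl (sym xsi≡xsj))

  insertAt-linked : (xs : Vector A (suc m)) (i : Fin (suc (suc m))) {v : A} → Linked R xs →
                    (∀ j → suc j ≡ i → R (xs j) v) → (∀ j → inject₁ j ≡ i → R v (xs j)) →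
                    Linked R (insertAt xs i v)
  insertAt-linked xs zero          _      _      after zero    = after zero refl
  insertAt-linked xs zero          linked _      _     (suc j) = linked j
  insertAt-linked xs (suc zero)    _      before _     zero    = before zero refl
  insertAt-linked {m = suc _} xs (suc (suc _)) linked _ _ zero = linked zero
  insertAt-linked {m = suc _} xs (suc i) linked before after (suc j) =
    insertAt-linked (tail xs) i (linked-tail {xs = xs} linked)
      (λ k e → before (suc k) (cong suc e)) (λ k e → after (suc k) (cong suc e)) j

insertAt-other : (xs : Vector A m) (i : Fin (suc m)) (v : A) {j : Fin (suc m)} (i≢j : i ≢ j) →
                 insertAt xs i v j ≡ xs (Fin.punchOut i≢j)
insertAt-other xs i v {j} i≢j = begin
  insertAt xs i v j                                    ≡⟨ cong (insertAt xs i v) (sym (punchIn-punchOut i≢j)) ⟩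
  insertAt xs i v (Fin.punchIn i (Fin.punchOut i≢j))   ≡⟨ insertAt-punchIn xs i v _ ⟩
  xs (Fin.punchOut i≢j)                                ∎
  where open ≡-Reasoning

insertAt-injective : {xs : Vector A m} {v : A} → Injective _≡_ _≡_ xs → (∀ j → xs j ≢ v) →
                     ∀ i → Injective _≡_ _≡_ (insertAt xs i v)
insertAt-injective {xs = xs} {v} xs-inj v∉xs i {j} {k} eq with i ≟ j | i ≟ k
... | yes refl | yes refl = refl
... | yes refl | no i≢k =
  contradiction (trans (sym (insertAt-other xs i v i≢k)) (trans (sym eq) (insertAt-lookup xs i v))) (v∉xs _)
... | no i≢j | yes refl =
  contradiction (trans (sym (insertAt-other xs i v i≢j)) (trans eq (insertAt-lookup xs i v))) (v∉xs _)
... | no i≢j | no i≢k =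
  punchOut-injective i≢j i≢k
    (xs-inj (trans (sym (insertAt-other xs i v i≢j)) (trans eq (insertAt-other xs i v i≢k))))

module _ {Q : Fin m → Set r}
         (ordered : ∀ {a b c} → a < b → b < c → Q a → Q b → Q c → ⊥) where

  distinct-triple : ∀ {i j k} → i ≢ j → j ≢ k → i ≢ k → Q i → Q j → Q k → ⊥
  distinct-triple {i} {j} {k} i≢j j≢k i≢k qi qj qk with <-cmp i j | <-cmp j k | <-cmp i k
  ... | tri≈ _ i≡j _ | _            | _            = i≢j i≡j
  ... | _            | tri≈ _ j≡k _ | _            = j≢k j≡k
  ... | _            | _            | tri≈ _ i≡k _ = i≢k i≡k
  ... | tri< i<j _ _ | tri< j<k _ _ | _            = ordered i<j j<k qi qj qk
  ... | tri< _ _ _   | tri> _ _ k<j | tri< i<k _ _ = ordered i<k k<j qi qk qj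
  ... | tri< i<j _ _ | tri> _ _ _   | tri> _ _ k<i = ordered k<i i<j qk qi qj
  ... | tri> _ _ j<i | tri< _ _ _   | tri< i<k _ _ = ordered j<i i<k qj qi qk
  ... | tri> _ _ _   | tri< j<k _ _ | tri> _ _ k<i = ordered j<k k<i qj qk qi
  ... | tri> _ _ j<i | tri> _ _ k<j | _            = ordered k<j j<i qk qj qi

module _ {n : ℕ} {G : Graph n} {ℓ : ℕ} (P : Path G ℓ) (x : Fin n) (x∉P : ¬ OnPath P x) where

  insertOffPath : (i : Fin (suc (suc ℓ))) →
                  (∀ j → suc j ≡ i → Adj G (vtx P j) x) → (∀ j → inject₁ j ≡ i → Adj G x (vtx P j)) →
                  Path G (suc ℓ)
  insertOffPath i before after = record
    { vtx = insertAt (vtx P) i x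
    ; inj = insertAt-injective (inj P) (λ j e → x∉P (j , e)) i
    ; adj = insertAt-linked {R = Adj G} (vtx P) i (adj P) before after
    }

  module _ (a b c : Fin ℓ) (a<b : suc a < inject₁ b) (b<c : suc b < inject₁ c)
           (va~x : Adj G (vtx P (suc a)) x) (vb~x : Adj G (vtx P (inject₁ b)) x)
           (vc~x : Adj G (vtx P (inject₁ c)) x) where

    spine : Vector (Fin (suc ℓ)) 6
    spine zero                               = inject₁ a
    spine (suc zero)                         = suc a
    spine (suc (suc zero))                   = inject₁ b
    spine (suc (suc (suc zero)))             = suc b
    spine (suc (suc (suc (suc zero))))       = inject₁ c
    spine (suc (suc (suc (suc (suc zero))))) = suc c

    spine-increasing : Linked _<_ spine
    spine-increasing zero                         = ≤̄⇒inject₁< ≤-refl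
    spine-increasing (suc zero)                   = a<b
    spine-increasing (suc (suc zero))             = ≤̄⇒inject₁< ≤-refl
    spine-increasing (suc (suc (suc zero)))       = b<c
    spine-increasing (suc (suc (suc (suc zero)))) = ≤̄⇒inject₁< ≤-refl

    embed : Vector (Fin n) 7
    embed zero    = x
    embed (suc i) = vtx P (spine i)

    embed-injective : Injective _≡_ _≡_ embed
    embed-injective {zero}  {zero}  _ = refl
    embed-injective {zero}  {suc j} e = contradiction (spine j , sym e) x∉P
    embed-injective {suc i} {zero}  e = contradiction (spine i , e) x∉P
    embed-injective {suc i} {suc j} e =
      cong suc (linked⇒injective {R = _<_} <-trans (λ i≡j → <-irrefl i≡j) spine-increasing (inj P e))

    -- Y's labels sent to the positions of their images in embed, which follow P.
    toPathOrder : Fin 7 → Fin 7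
    toPathOrder zero                                     = zero
    toPathOrder (suc zero)                               = # 2
    toPathOrder (suc (suc zero))                         = # 3
    toPathOrder (suc (suc (suc zero)))                   = # 5
    toPathOrder (suc (suc (suc (suc zero))))             = # 1
    toPathOrder (suc (suc (suc (suc (suc zero)))))       = # 4
    toPathOrder (suc (suc (suc (suc (suc (suc zero)))))) = # 6

    fromPathOrder : Fin 7 → Fin 7
    fromPathOrder zero                                     = zero
    fromPathOrder (suc zero)                               = # 4
    fromPathOrder (suc (suc zero))                         = # 1
    fromPathOrder (suc (suc (suc zero)))                   = # 2
    fromPathOrder (suc (suc (suc (suc zero))))             = # 5
    fromPathOrder (suc (suc (suc (suc (suc zero)))))       = # 3
    fromPathOrder (suc (suc (suc (suc (suc (suc zero)))))) = # 6

    fromPathOrder∘toPathOrder : ∀ i → fromPathOrder (toPathOrder i) ≡ i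
    fromPathOrder∘toPathOrder zero                                     = refl
    fromPathOrder∘toPathOrder (suc zero)                               = refl
    fromPathOrder∘toPathOrder (suc (suc zero))                         = refl
    fromPathOrder∘toPathOrder (suc (suc (suc zero)))                   = refl
    fromPathOrder∘toPathOrder (suc (suc (suc (suc zero))))             = refl
    fromPathOrder∘toPathOrder (suc (suc (suc (suc (suc zero)))))       = refl
    fromPathOrder∘toPathOrder (suc (suc (suc (suc (suc (suc zero)))))) = refl

    toPathOrder-injective : Injective _≡_ _≡_ toPathOrder
    toPathOrder-injective {i} {j} e = begin
      i                              ≡⟨ sym (fromPathOrder∘toPathOrder i) ⟩
      fromPathOrder (toPathOrder i)  ≡⟨ cong fromPathOrder e ⟩
      fromPathOrder (toPathOrder j)  ≡⟨ fromPathOrder∘toPathOrder j ⟩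
      j                              ∎
      where open ≡-Reasoning

    embed-Y-edges : ∀ u v → YEdge u v → Adj G (embed (toPathOrder u)) (embed (toPathOrder v))
    embed-Y-edges _ _ e01 = Graph.sym G va~x
    embed-Y-edges _ _ e02 = Graph.sym G vb~x
    embed-Y-edges _ _ e03 = Graph.sym G vc~x
    embed-Y-edges _ _ e14 = Graph.sym G (adj P a)
    embed-Y-edges _ _ e25 = adj P b
    embed-Y-edges _ _ e36 = adj P c

    spread-neighbours⇒Y : HasYSubgraph G
    spread-neighbours⇒Y =
      (λ u → embed (toPathOrder u)) , (λ e → toPathOrder-injective (embed-injective e)) , embed-Y-edges

  module _ (longest : Longest P) where

    ¬insertable : (i : Fin (suc (suc ℓ))) →
                  (∀ j → suc j ≡ i → Adj G (vtx P j) x) → ¬ (∀ j → inject₁ j ≡ i → Adj G x (vtx P j))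
    ¬insertable i before after = ℕ.1+n≰n (longest (suc ℓ) (insertOffPath i before after))

    ¬adj-first : ¬ Adj G (vtx P zero) x
    ¬adj-first v₀~x = ¬insertable zero (λ _ ()) λ { zero refl → Graph.sym G v₀~x }

    ¬adj-last : ¬ Adj G (vtx P (fromℕ ℓ)) x
    ¬adj-last vℓ~x =
      ¬insertable (suc (fromℕ ℓ)) (λ { _ refl → vℓ~x }) (λ _ e → contradiction (sym e) fromℕ≢inject₁)

    ¬adj-consecutive : ∀ b → Adj G (vtx P (inject₁ b)) x → ¬ Adj G (vtx P (suc b)) x
    ¬adj-consecutive b vb~x vb+1~x = ¬insertable (suc (inject₁ b)) (λ { _ refl → vb~x })
      (λ _ e → subst (λ k → Adj G x (vtx P k)) (sym (inject₁-injective e)) (Graph.sym G vb+1~x))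

    ¬three-neighbours : ¬ HasYSubgraph G → ∀ {a b c} → a < b → b < c →
                        Adj G (vtx P a) x → Adj G (vtx P b) x → ¬ Adj G (vtx P c) x
    ¬three-neighbours _ {zero} _ _ va~x _ _ = ¬adj-first va~x
    ¬three-neighbours noY {suc a} {b} {c} a<b b<c va~x vb~x vc~x with view c | view b
    ... | ‵fromℕ      | _           = ¬adj-last vc~x
    ... | ‵inject₁ _  | ‵fromℕ      = ℕ.<-irrefl refl (ℕ.<-≤-trans b<c (≤fromℕ _))
    ... | ‵inject₁ c′ | ‵inject₁ b′ with suc b′ ≟ inject₁ c′
    ...   | yes b′+1≡c′ = ¬adj-consecutive b′ vb~x (subst (λ k → Adj G (vtx P k) x) (sym b′+1≡c′) vc~x)
    ...   | no  b′+1≢c′ = noY (spread-neighbours⇒Y a b′ c′ a<b b′+1<c′ va~x vb~x vc~x)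
      where
        b′+1<c′ : suc b′ < inject₁ c′
        b′+1<c′ = ≤∧≢⇒< (subst (λ t → suc t ≤ _) (toℕ-inject₁ b′) b<c) b′+1≢c′

lemma2p8 : ∀ {n : ℕ} (G : Graph n) → Connected G → ¬ HasYSubgraph G →
    ∀ {ℓ : ℕ} (P : Path G ℓ) → Longest P → 5 ≤ ℓ →
    ∀ (i j k : Fin (suc ℓ)) → ¬ i ≡ j → ¬ j ≡ k → ¬ i ≡ k →
    ∀ (x : Fin n) → ¬ (L P i x × L P j x × L P k x)
lemma2p8 G _ noY P longest _ i j k i≢j j≢k i≢k x ((vi~x , x∉P) , (vj~x , _) , (vk~x , _)) =
  distinct-triple {Q = λ p → Adj G (vtx P p) x} (¬three-neighbours P x x∉P longest noY)
    i≢j j≢k i≢k vi~x vj~x vk~x
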